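{- Let $D$ be a defeasible theory, let $S_D$ and $S^*_D$ be its compiled programs, and let $q(\vec a)$ be a ground literal ($q$ is $p$ or $\neg p$ in $D$, written $\mathtt{p}$ or $\mathtt{not\_p}$ in the programs). Then $q(\vec a)\in P_\Delta$ iff $S_D\models_{WF}\mathtt{definitely\_q}(\vec a)$ iff $S^*_D\models_{WF}\mathtt{definitely\_q}(\vec a)$; and $q(\vec a)\in P_\lambda$ iff $S_D\models_{WF}\mathtt{lambda\_q}(\vec a)$ iff $S^*_D\models_{WF}\mathtt{lambda\_q}(\vec a)$.
   Context: Defeasible theories. A literal is an atom $p(t_1,\dots,t_n)$ or its classical negation; ${\sim}q$ is the complementary literal. A defeasible theory $D=(F,R,>)$ consists of a finite set $F$ of variable-free literals (facts), a finite set $R$ of labelled rules $r$ with antecedent set $A(r)$, consequent $C(r)$ and kind strict ($\to$), defeasible ($\Rightarrow$) or defeater ($\leadsto$), and an acyclic superiority relation $>$ on labels. $R_s$: strict rules; $R_{sd}$: strict or defeasible rules; $R[q]$: rules with consequent $q$. A non-ground theory is identified with the set of ground instances of its rules. $P_\Delta$ is the least set of ground literals with $q\in P_\Delta$ whenever $q\in F$ or some $r\in R_s[q]$ has $A(r)\subseteq P_\Delta$. $P_\lambda$ is the least set with $q\in P_\lambda$ whenever $q\in P_\Delta$, or some $r\in R_{sd}[q]$ has $A(r)\subseteq P_\lambda$ and ${\sim}q\notin P_\Delta$. Compiled programs. For a literal $q$ with predicate $p$, $\mathtt{q}$ denotes $\mathtt{p}$ if $q$ is positive and $\mathtt{not\_p}$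 if negative; $\mathtt{{\sim}q}$ is the name of the complement; predicate names are formed by concatenation; rule labels are constants. $S_D$ consists exactly of: (i) for each fact $q(\vec a)$: unit clauses $\mathtt{definitely\_q}(\vec a)$, $\mathtt{lambda\_q}(\vec a)$, $\mathtt{defeasibly\_q}(\vec a)$; (ii) for each strict rule $r:q_1(\vec a_1),\dots,q_n(\vec a_n)\to q(\vec a)$: $\mathtt{definitely\_q}(\vec a)\,\text{:- }\,\mathtt{body}^\Delta_r(\vec a)$, $\mathtt{lambda\_q}(\vec a)\,\text{:- }\,\mathtt{body}^\Delta_r(\vec a)$, $\mathtt{defeasibly\_q}(\vec a)\,\text{:- }\,\mathtt{body}^\Delta_r(\vec a)$, $\mathtt{body}^\Delta_r(\vec a)\,\text{:- }\,\mathtt{definitely\_q_1}(\vec a_1),\dots,\mathtt{definitely\_q_n}(\vec a_n)$; (iii) for each strict or defeasible rule $r:q_1(\vec a_1),\dots,q_n(\vec a_n)\hookrightarrow q(\vec a)$: $\mathtt{lambda\_q}(\vec a)\,\text{:- }\,not\ \mathtt{definitely\_{\sim}q}(\vec a),\mathtt{body}^\lambda_r(\vec a)$ and $\mathtt{defeasibly\_q}(\vec a)\,\text{:- }\,not\ \mathtt{definitely\_{\sim}q}(\vec a),\mathtt{body}^d_r(\vec a),not\ \mathtt{overruled\_q}(\vec a)$; (iv) for each rule $s$ of any kind, $s:q_1(\vec a_1),\dots,q_n(\vec a_n)\hookrightarrow q(\vec a)$: $\mathtt{body}^\lambda_s(\vec a)\,\text{:- }\,\mathtt{lambda\_q_1}(\vec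 a_1),\dots,\mathtt{lambda\_q_n}(\vec a_n)$, $\mathtt{body}^d_s(\vec a)\,\text{:- }\,\mathtt{defeasibly\_q_1}(\vec a_1),\dots,\mathtt{defeasibly\_q_n}(\vec a_n)$, $\mathtt{overruled\_{\sim}q}(\vec a)\,\text{:- }\,\mathtt{body}^\lambda_s(\vec a),not\ \mathtt{defeated\_q}(s,\vec a)$; (v) for each strict or defeasible rule $t$ with consequent $q(\vec a)$ and each rule $s$ with consequent of the form ${\sim}q(\dots)$ with $t>s$: $\mathtt{defeated\_{\sim}q}(s,\vec a)\,\text{:- }\,\mathtt{body}^d_t(\vec a)$. $S^*_D$ is the same as $S_D$ except that the $\mathtt{defeasibly\_q}$ clauses of (iii), the $\mathtt{overruled}$ clauses of (iv) and the clauses of (v) are replaced by: for each strict or defeasible rule $r$ with consequent $q(\vec a)$, $\mathtt{defeasibly\_q}(\vec a)\,\text{:- }\,not\ \mathtt{definitely\_{\sim}q}(\vec a),\mathtt{body}^d_r(\vec a),not\ \mathtt{overruled\_q}(r,\vec a)$; for each such $r$ and each rule $s$ with consequent ${\sim}q(\vec b)$, $\mathtt{overruled\_q}(r,\vec b)\,\text{:- }\,\mathtt{body}^\lambda_s(\vec b),not\ \mathtt{defeats\_q}(r,s)$; for each $r>s$ with $r$ having consequent literal $q$, the unit clause $\mathtt{defeats\_q}(r,s)$. $P\models_{WF}\ell$ means the ground literal $\ell$ holds in the well-founded model of the logic program $P$. -}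

module Defs where

open import Data.Bool using (Bool; true; false; not)
open import Data.Empty using (⊥)
open import Data.List using (List; []; _∷_; map)
open import Data.List.Membership.Propositional using (_∈_)
open import Data.List.Relation.Unary.All using (All)
open import Data.List.Relation.Unary.Unique.Propositional using (Unique)
open import Data.Product using (_×_; _,_)
open import Relation.Binary.PropositionalEquality using (_≡_)
open import Relation.Binary.Construct.Closure.Transitive using (TransClosure)
open import Relation.Nullary using (¬_)
open import Level using (suc; zero)

-- Well-founded semantics of (possibly infinite, ground) normal logic
-- programs over an arbitrary set of ground atoms, via Van Gelder's
-- alternating fixpoint: the true atoms of the WF model are the least
-- fixpoint of Γ∘Γ, where Γ(I) is the least model of the
-- Gelfond–Lifschitz reduct of P w.r.t. I.

module LP (Atom : Set) where

  record Clause : Set where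
    constructor _:-_∣_
    field
      head : Atom
      pos  : List Atom
      neg  : List Atom

  Program : Set₁
  Program = Clause → Set

  data Γ (P : Program) (I : Atom → Set) : Atom → Set where
    step : ∀ (c : Clause) → P c
         → All (Γ P I) (Clause.pos c)
         → All (λ b → ¬ I b) (Clause.neg c)
         → Γ P I (Clause.head c)

  WFTrue : Program → Atom → Set₁
  WFTrue P a = ∀ (S : Atom → Set) → (∀ b → Γ P (Γ P S) b → S b) → S a

  _⊨WF_ : Program → Atom → Set₁
  P ⊨WF a = WFTrue P a

module Theory (Pred Fun Var Label : Set) where

  data Term (V : Set) : Set where
    var : V → Term V
    fn  : Fun → List (Term V) → Term V

  GTerm : Set
  GTerm = Term ⊥

  mutual
    sub : (Var → GTerm) → Term Var → GTerm
    sub σ (var x)   = σ x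
    sub σ (fn f ts) = fn f (subs σ ts)

    subs : (Var → GTerm) → List (Term Var) → List GTerm
    subs σ []       = []
    subs σ (t ∷ ts) = sub σ t ∷ subs σ ts

  -- literal: sign (true = positive p, false = classical negation ¬p),
  -- predicate symbol, argument list
  record Lit (A : Set) : Set where
    constructor lit
    field
      sign : Bool
      pred : Pred
      args : List A
  open Lit public

  GLit : Set
  GLit = Lit GTerm

  ∼_ : ∀ {A} → Lit A → Lit A
  ∼ lit s p as = lit (not s) p as

  instL : (Var → GTerm) → Lit (Term Var) → GLit
  instL σ (lit s p as) = lit s p (subs σ as)

  data Kind : Set where
    strict defeasible defeater : Kind

  data SD : Kind → Set where
    sd-strict     : SD strict
    sd-defeasible : SD defeasible

  record Rule : Set where
    field
      label : Label
      kind  : Kind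
      ante  : List (Lit (Term Var))
      cons  : Lit (Term Var)
  open Rule public

  headσ : Rule → (Var → GTerm) → GLit
  headσ r σ = instL σ (cons r)

  anteσ : Rule → (Var → GTerm) → List GLit
  anteσ r σ = map (instL σ) (ante r)

  Opposes : Rule → Rule → Set
  Opposes s t = (sign (cons s) ≡ not (sign (cons t))) × (pred (cons s) ≡ pred (cons t))

  record DefeasibleTheory : Set where
    field
      facts   : List GLit
      rules   : List Rule
      sup     : List (Label × Label)
      labels-unique : Unique (map label rules)
      sup-acyclic   : ∀ l → ¬ TransClosure (λ r s → (r , s) ∈ sup) l l
  open DefeasibleTheory public

  _⊢_≻_ : DefeasibleTheory → Label → Label → Set
  D ⊢ r ≻ s = (r , s) ∈ sup D

  data PΔ (D : DefeasibleTheory) : GLit → Set where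
    fact   : ∀ {q} → q ∈ facts D → PΔ D q
    strict : ∀ {r} → r ∈ rules D → kind r ≡ strict → (σ : Var → GTerm)
           → All (PΔ D) (anteσ r σ) → PΔ D (headσ r σ)

  data Pλ (D : DefeasibleTheory) : GLit → Set where
    fromΔ : ∀ {q} → PΔ D q → Pλ D q
    rule  : ∀ {r} → r ∈ rules D → SD (kind r) → (σ : Var → GTerm)
          → All (Pλ D) (anteσ r σ) → ¬ PΔ D (∼ headσ r σ)
          → Pλ D (headσ r σ)

  -- atoms of the compiled programs (structured names instead of
  -- concatenated strings; arguments are ground terms / label constants)
  data PAtom : Set where
    definitely  : GLit → PAtom
    lambda      : GLit → PAtom
    defeasibly  : GLit → PAtom
    bodyΔ       : Label → List GTerm → PAtom
    bodyλ       : Label → List GTerm → PAtom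
    bodyd       : Label → List GTerm → PAtom
    overruled   : GLit → PAtom
    defeated    : GLit → Label → PAtom
    overruled*  : GLit → Label → PAtom
    defeats     : Bool → Pred → Label → Label → PAtom

  open LP PAtom public

  private
    defs : List GLit → List PAtom
    defs = map definitely
    lams : List GLit → List PAtom
    lams = map lambda
    dfs : List GLit → List PAtom
    dfs = map defeasibly

  data Common (D : DefeasibleTheory) : Program where
    i-def : ∀ {q} → q ∈ facts D → Common D (definitely q :- [] ∣ [])
    i-lam : ∀ {q} → q ∈ facts D → Common D (lambda q :- [] ∣ [])
    i-dfs : ∀ {q} → q ∈ facts D → Common D (defeasibly q :- [] ∣ [])
    ii-def : ∀ {r} → r ∈ rules D → kind r ≡ strict → (σ : Var → GTerm) →
      Common D (definitely (headσ r σ) :- (bodyΔ (label r) (args (headσ r σ)) ∷ []) ∣ [])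
    ii-lam : ∀ {r} → r ∈ rules D → kind r ≡ strict → (σ : Var → GTerm) →
      Common D (lambda (headσ r σ) :- (bodyΔ (label r) (args (headσ r σ)) ∷ []) ∣ [])
    ii-dfs : ∀ {r} → r ∈ rules D → kind r ≡ strict → (σ : Var → GTerm) →
      Common D (defeasibly (headσ r σ) :- (bodyΔ (label r) (args (headσ r σ)) ∷ []) ∣ [])
    ii-body : ∀ {r} → r ∈ rules D → kind r ≡ strict → (σ : Var → GTerm) →
      Common D (bodyΔ (label r) (args (headσ r σ)) :- defs (anteσ r σ) ∣ [])
    iii-lam : ∀ {r} → r ∈ rules D → SD (kind r) → (σ : Var → GTerm) →
      Common D (lambda (headσ r σ)
                 :- (bodyλ (label r) (args (headσ r σ)) ∷ [])
                 ∣ (definitely (∼ headσ r σ) ∷ []))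
    iv-bodyλ : ∀ {s} → s ∈ rules D → (σ : Var → GTerm) →
      Common D (bodyλ (label s) (args (headσ s σ)) :- lams (anteσ s σ) ∣ [])
    iv-bodyd : ∀ {s} → s ∈ rules D → (σ : Var → GTerm) →
      Common D (bodyd (label s) (args (headσ s σ)) :- dfs (anteσ s σ) ∣ [])

  data S (D : DefeasibleTheory) : Program where
    common : ∀ {c} → Common D c → S D c
    iii-dfs : ∀ {r} → r ∈ rules D → SD (kind r) → (σ : Var → GTerm) →
      S D (defeasibly (headσ r σ)
            :- (bodyd (label r) (args (headσ r σ)) ∷ [])
            ∣ (definitely (∼ headσ r σ) ∷ overruled (headσ r σ) ∷ []))
    iv-overruled : ∀ {s} → s ∈ rules D → (σ : Var → GTerm) →
      S D (overruled (∼ headσ s σ)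
            :- (bodyλ (label s) (args (headσ s σ)) ∷ [])
            ∣ (defeated (headσ s σ) (label s) ∷ []))
    v-defeated : ∀ {t s} → t ∈ rules D → SD (kind t) → s ∈ rules D →
      Opposes s t → D ⊢ label t ≻ label s → (σ : Var → GTerm) →
      S D (defeated (∼ headσ t σ) (label s)
            :- (bodyd (label t) (args (headσ t σ)) ∷ []) ∣ [])

  data S* (D : DefeasibleTheory) : Program where
    common : ∀ {c} → Common D c → S* D c
    dfs* : ∀ {r} → r ∈ rules D → SD (kind r) → (σ : Var → GTerm) →
      S* D (defeasibly (headσ r σ)
             :- (bodyd (label r) (args (headσ r σ)) ∷ [])
             ∣ (definitely (∼ headσ r σ) ∷ overruled* (headσ r σ) (label r) ∷ []))
    overruled*-cl : ∀ {r s} → r ∈ rules D → SD (kind r) → s ∈ rules D →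
      Opposes s r → (σ : Var → GTerm) →
      S* D (overruled* (∼ headσ s σ) (label r)
             :- (bodyλ (label s) (args (headσ s σ)) ∷ [])
             ∣ (defeats (sign (cons r)) (pred (cons r)) (label r) (label s) ∷ []))
    defeats-cl : ∀ {r} {s : Label} → r ∈ rules D → D ⊢ label r ≻ s →
      S* D (defeats (sign (cons r)) (pred (cons r)) (label r) s :- [] ∣ [])

{-# OPTIONS --safe #-}
module Submission where

open import Defs
open import Data.Empty using (⊥-elim)
open import Data.List using (List; []; _∷_; map)
open import Data.List.Membership.Propositional using (_∈_)
open import Data.List.Relation.Unary.All using (All; []; _∷_; lookup)
open import Data.List.Relation.Unary.All.Properties using (map⁻)
open import Data.List.Relation.Unary.Any using (here; there)
open import Data.List.Relation.Unary.AllPairs using (_∷_)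
open import Data.List.Relation.Unary.Unique.Propositional using (Unique)
open import Data.Product using (_×_; _,_; Σ)
open import Data.Sum using (_⊎_; inj₁; inj₂)
open import Data.Unit using (⊤; tt)
open import Function.Bundles using (_⇔_; mk⇔)
open import Function.Construct.Composition using (_⇔-∘_)
open import Function.Construct.Symmetry using (⇔-sym)
open import Relation.Binary.PropositionalEquality using (_≡_; refl; sym; cong; subst)
open import Relation.Nullary using (¬_)

-- The clauses for definitely_, lambda_ and the body atoms are shared by S_D and S*_D,
-- and no shared clause mentions the remaining atoms (defeasibly_, overruled_, …).
-- The definitely_ part is negation-free and mirrors the inductive definition of P_Δ,
-- so it is decided in the first application of Γ. The lambda_ part negates only
-- definitely_ atoms, which are then exactly P_Δ, and so mirrors the definition of P_λ.
-- Hence, in every program of this shape, the well-founded model agrees with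
-- (P_Δ, P_λ) on these atoms, whatever the other clauses are.

Unique-map⇒injective : ∀ {a b} {A : Set a} {B : Set b} {f : A → B} {xs : List A} {x y : A} →
  Unique (map f xs) → x ∈ xs → y ∈ xs → f x ≡ f y → x ≡ y
Unique-map⇒injective _        (here refl) (here refl) _     = refl
Unique-map⇒injective (x∉ ∷ _) (here refl) (there y∈) fx≡fy = ⊥-elim (lookup (map⁻ x∉) y∈ fx≡fy)
Unique-map⇒injective (y∉ ∷ _) (there x∈) (here refl) fx≡fy = ⊥-elim (lookup (map⁻ y∉) x∈ (sym fx≡fy))
Unique-map⇒injective (_ ∷ u)  (there x∈) (there y∈) fx≡fy = Unique-map⇒injective u x∈ y∈ fx≡fy

module Compilation {Pred Fun Var Label : Set} (D : Theory.DefeasibleTheory Pred Fun Var Label) where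
  open Theory Pred Fun Var Label

  rule-label-injective : ∀ {r r′} → r ∈ rules D → r′ ∈ rules D → label r ≡ label r′ → r ≡ r′
  rule-label-injective = Unique-map⇒injective (labels-unique D)

  instL-args-injective : ∀ l σ σ′ → args (instL σ l) ≡ args (instL σ′ l) → instL σ l ≡ instL σ′ l
  instL-args-injective (lit s p as) σ σ′ = cong (lit s p)

  StrictBodyΔ : Label → List GTerm → Set
  StrictBodyΔ l a = Σ Rule λ r → r ∈ rules D × kind r ≡ strict × Σ (Var → GTerm) λ σ →
    label r ≡ l × args (headσ r σ) ≡ a × All (PΔ D) (anteσ r σ)

  Bodyλ : Label → List GTerm → Set
  Bodyλ l a = Σ Rule λ r → r ∈ rules D × Σ (Var → GTerm) λ σ →
    label r ≡ l × args (headσ r σ) ≡ a × All (Pλ D) (anteσ r σ)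

  -- A body atom records only the label and the head arguments; uniqueness of labels
  -- recovers the rule, and then the head literal.
  StrictBodyΔ⇒PΔ : ∀ {r σ} → r ∈ rules D →
    StrictBodyΔ (label r) (args (headσ r σ)) → PΔ D (headσ r σ)
  StrictBodyΔ⇒PΔ {r} {σ} r∈ (r′ , r′∈ , k , σ′ , same-label , same-args , ante)
    with rule-label-injective r′∈ r∈ same-label
  ... | refl = subst (PΔ D) (instL-args-injective (cons r) σ′ σ same-args) (strict r′∈ k σ′ ante)

  Bodyλ⇒Pλ : ∀ {r σ} → r ∈ rules D → SD (kind r) → ¬ PΔ D (∼ headσ r σ) →
    Bodyλ (label r) (args (headσ r σ)) → Pλ D (headσ r σ)
  Bodyλ⇒Pλ {r} {σ} r∈ sd ∼q∉PΔ (r′ , r′∈ , σ′ , same-label , same-args , ante)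
    with rule-label-injective r′∈ r∈ same-label
  ... | refl = subst (Pλ D) same-head (rule r∈ sd σ′ ante ∼q′∉PΔ)
    where
      same-head : headσ r σ′ ≡ headσ r σ
      same-head = instL-args-injective (cons r) σ′ σ same-args
      ∼q′∉PΔ : ¬ PΔ D (∼ headσ r σ′)
      ∼q′∉PΔ p = ∼q∉PΔ (subst (λ q → PΔ D (∼ q)) same-head p)

  ⟦_⟧ : PAtom → Set
  ⟦ definitely q ⟧ = PΔ D q
  ⟦ lambda q ⟧     = Pλ D q
  ⟦ bodyΔ l a ⟧    = StrictBodyΔ l a
  ⟦ bodyλ l a ⟧    = Bodyλ l a
  ⟦ _ ⟧            = ⊤

  -- Clauses outside Common D have heads on which ⟦_⟧ is trivially true, i.e. heads
  -- that are not definitely_, lambda_ or body atoms.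
  module CompiledProgram (P : Program)
      (Common⊆P : ∀ {c} → Common D c → P c)
      (P⊆Common⊎⟦head⟧ : ∀ {c} → P c → Common D c ⊎ ⟦ Clause.head c ⟧) where

    mutual
      PΔ⇒Γ : ∀ {J q} → PΔ D q → Γ P J (definitely q)
      PΔ⇒Γ (fact q∈) = step _ (Common⊆P (i-def q∈)) [] []
      PΔ⇒Γ (strict r∈ k σ ante) =
        step _ (Common⊆P (ii-def r∈ k σ)) (StrictBodyΔ⇒Γ r∈ k σ ante ∷ []) []

      StrictBodyΔ⇒Γ : ∀ {J r} → r ∈ rules D → kind r ≡ strict → ∀ σ →
        All (PΔ D) (anteσ r σ) → Γ P J (bodyΔ (label r) (args (headσ r σ)))
      StrictBodyΔ⇒Γ r∈ k σ ante = step _ (Common⊆P (ii-body r∈ k σ)) (All-PΔ⇒Γ ante) []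

      All-PΔ⇒Γ : ∀ {J qs} → All (PΔ D) qs → All (Γ P J) (map definitely qs)
      All-PΔ⇒Γ []       = []
      All-PΔ⇒Γ (p ∷ ps) = PΔ⇒Γ p ∷ All-PΔ⇒Γ ps

    mutual
      Pλ⇒Γ : ∀ {J q} → (∀ {q′} → J (definitely q′) → PΔ D q′) → Pλ D q → Γ P J (lambda q)
      Pλ⇒Γ J⊆PΔ (fromΔ (fact q∈)) = step _ (Common⊆P (i-lam q∈)) [] []
      Pλ⇒Γ J⊆PΔ (fromΔ (strict r∈ k σ ante)) =
        step _ (Common⊆P (ii-lam r∈ k σ)) (StrictBodyΔ⇒Γ r∈ k σ ante ∷ []) []
      Pλ⇒Γ J⊆PΔ (rule r∈ sd σ ante ∼q∉PΔ) =
        step _ (Common⊆P (iii-lam r∈ sd σ))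
          (step _ (Common⊆P (iv-bodyλ r∈ σ)) (All-Pλ⇒Γ J⊆PΔ ante) [] ∷ [])
          ((λ ∼q∈J → ∼q∉PΔ (J⊆PΔ ∼q∈J)) ∷ [])

      All-Pλ⇒Γ : ∀ {J qs} → (∀ {q′} → J (definitely q′) → PΔ D q′) →
        All (Pλ D) qs → All (Γ P J) (map lambda qs)
      All-Pλ⇒Γ J⊆PΔ []       = []
      All-Pλ⇒Γ J⊆PΔ (p ∷ ps) = Pλ⇒Γ J⊆PΔ p ∷ All-Pλ⇒Γ J⊆PΔ ps

    mutual
      Γ⇒⟦⟧ : ∀ {J a} → (∀ {q} → PΔ D q → J (definitely q)) → Γ P J a → ⟦ a ⟧
      Γ⇒⟦⟧ PΔ⊆J (step c c∈P pos neg) with P⊆Common⊎⟦head⟧ c∈P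
      ... | inj₁ c∈Common = Common-Γ⇒⟦⟧ PΔ⊆J c∈Common pos neg
      ... | inj₂ ⟦head⟧   = ⟦head⟧

      Common-Γ⇒⟦⟧ : ∀ {J c} → (∀ {q} → PΔ D q → J (definitely q)) → Common D c →
        All (Γ P J) (Clause.pos c) → All (λ b → ¬ J b) (Clause.neg c) → ⟦ Clause.head c ⟧
      Common-Γ⇒⟦⟧ PΔ⊆J (i-def q∈) _ _ = fact q∈
      Common-Γ⇒⟦⟧ PΔ⊆J (i-lam q∈) _ _ = fromΔ (fact q∈)
      Common-Γ⇒⟦⟧ PΔ⊆J (i-dfs _)  _ _ = tt
      Common-Γ⇒⟦⟧ PΔ⊆J (ii-def r∈ _ _) (body ∷ []) _ = StrictBodyΔ⇒PΔ r∈ (Γ⇒⟦⟧ PΔ⊆J body)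
      Common-Γ⇒⟦⟧ PΔ⊆J (ii-lam r∈ _ _) (body ∷ []) _ = fromΔ (StrictBodyΔ⇒PΔ r∈ (Γ⇒⟦⟧ PΔ⊆J body))
      Common-Γ⇒⟦⟧ PΔ⊆J (ii-dfs _ _ _) _ _ = tt
      Common-Γ⇒⟦⟧ PΔ⊆J (ii-body {r} r∈ k σ) ante _ =
        r , r∈ , k , σ , refl , refl , All-Γ⇒⟦⟧ PΔ⊆J (anteσ r σ) ante
      Common-Γ⇒⟦⟧ PΔ⊆J (iii-lam r∈ sd _) (body ∷ []) (∼q∉J ∷ []) =
        Bodyλ⇒Pλ r∈ sd (λ ∼q∈PΔ → ∼q∉J (PΔ⊆J ∼q∈PΔ)) (Γ⇒⟦⟧ PΔ⊆J body)
      Common-Γ⇒⟦⟧ PΔ⊆J (iv-bodyλ {s} s∈ σ) ante _ =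
        s , s∈ , σ , refl , refl , All-Γ⇒⟦⟧ PΔ⊆J (anteσ s σ) ante
      Common-Γ⇒⟦⟧ PΔ⊆J (iv-bodyd _ _) _ _ = tt

      All-Γ⇒⟦⟧ : ∀ {J} {f : GLit → PAtom} → (∀ {q} → PΔ D q → J (definitely q)) →
        ∀ qs → All (Γ P J) (map f qs) → All (λ q → ⟦ f q ⟧) qs
      All-Γ⇒⟦⟧ PΔ⊆J []       []       = []
      All-Γ⇒⟦⟧ PΔ⊆J (q ∷ qs) (d ∷ ds) = Γ⇒⟦⟧ PΔ⊆J d ∷ All-Γ⇒⟦⟧ PΔ⊆J qs ds

    Γ²-closed : (PAtom → Set) → Set
    Γ²-closed S = ∀ b → Γ P (Γ P S) b → S b

    ⟦⟧-Γ²-closed : Γ²-closed ⟦_⟧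
    ⟦⟧-Γ²-closed _ = Γ⇒⟦⟧ PΔ⇒Γ

    PΔ⊆Γ²-closed : ∀ {S q} → Γ²-closed S → PΔ D q → S (definitely q)
    PΔ⊆Γ²-closed closed p = closed _ (PΔ⇒Γ p)

    PΔ⇔⊨WF : ∀ q → PΔ D q ⇔ (P ⊨WF definitely q)
    PΔ⇔⊨WF q = mk⇔ (λ p S closed → PΔ⊆Γ²-closed closed p)
                   (λ wf → wf ⟦_⟧ ⟦⟧-Γ²-closed)

    Pλ⇔⊨WF : ∀ q → Pλ D q ⇔ (P ⊨WF lambda q)
    Pλ⇔⊨WF q = mk⇔ (λ p S closed → closed _ (Pλ⇒Γ (Γ⇒⟦⟧ (PΔ⊆Γ²-closed closed)) p))
                   (λ wf → wf ⟦_⟧ ⟦⟧-Γ²-closed)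

  S-shape : ∀ {c} → S D c → Common D c ⊎ ⟦ Clause.head c ⟧
  S-shape (common c∈) = inj₁ c∈
  S-shape (iii-dfs _ _ _) = inj₂ tt
  S-shape (iv-overruled _ _) = inj₂ tt
  S-shape (v-defeated _ _ _ _ _ _) = inj₂ tt

  S*-shape : ∀ {c} → S* D c → Common D c ⊎ ⟦ Clause.head c ⟧
  S*-shape (common c∈) = inj₁ c∈
  S*-shape (dfs* _ _ _) = inj₂ tt
  S*-shape (overruled*-cl _ _ _ _ _) = inj₂ tt
  S*-shape (defeats-cl _ _) = inj₂ tt

  module ForS  = CompiledProgram (S D) common S-shape
  module ForS* = CompiledProgram (S* D) common S*-shape

theorem4 : (Pred Fun Var Label : Set) →
    let open Theory Pred Fun Var Label in
    (D : DefeasibleTheory) (q : GLit) →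
      ((PΔ D q ⇔ (S D ⊨WF definitely q)) × ((S D ⊨WF definitely q) ⇔ (S* D ⊨WF definitely q)))
      × ((Pλ D q ⇔ (S D ⊨WF lambda q)) × ((S D ⊨WF lambda q) ⇔ (S* D ⊨WF lambda q)))
theorem4 Pred Fun Var Label D q =
  (ForS.PΔ⇔⊨WF q , ForS*.PΔ⇔⊨WF q ⇔-∘ ⇔-sym (ForS.PΔ⇔⊨WF q)) ,
  (ForS.Pλ⇔⊨WF q , ForS*.Pλ⇔⊨WF q ⇔-∘ ⇔-sym (ForS.Pλ⇔⊨WF q))
  where open Compilation D
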